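{- In the name-boundedness type system: let $\mu X.P$ be a process in which all binding occurrences of recursion variables are distinct. If $\Gamma, \Delta \vdash \mu X.P$, then there is at most one occurrence of $X$ in $P$.
   Context: Calculus. Names range over a countably infinite set $\mathcal N$, recursion variables over a countably infinite set $\mathcal R$. Polarities are $+,-,\varepsilon$ with $\overline{+}=-$, $\overline{ - }=+$, $\overline{\varepsilon}=\varepsilon$; $x^p$ is a polarized name. Processes: $P ::= x^p(y).P \mid x^p\langle y^q\rangle.P \mid P_1 \mid P_2 \mid (\nu x:T)P \mid \mu X.P \mid X \mid \mathbf{0}$, with $T$ a type; $y$ is bound in $x^p(y).P$, $x$ in $(\nu x:T)P$, $X$ in $\mu X.P$; recursion is guarded (every occurrence of a recursion variable lies under an input or output prefix). All free and bound names are assumed pairwise distinct. Types of the name-boundedness system: $S_{\mathsf{lin}} ::= {?T_{\mathsf{lin}}}.S_{\mathsf{lin}} \mid {!T_{\mathsf{lin}}}.S_{\mathsf{lin}} \mid \mathsf{end}$; $S_{\mathsf{un}} ::= \mathsf{ch}(S_{\mathsf{un}})$; $T_{\mathsf{lin}} ::= (S_{\mathsf{lin}},S_{\mathsf{un}}) \mid (S_{\mathsf{lin}},S_{\mathsf{lin}})$; $T ::= T_{\mathsf{lin}} \mid S_{\mathsf{un}}$. Duality: $\overline{{!T}.S}={?T}.\overline S$, $\overline{{?T}.S}={!T}.\overline S$, $\overline{\mathsf{end}}=\mathsf{end}$. A type environment $\Gamma$ is a finite partial function from polarized names to types, written as a list $x^p:T,\dots$. $\Gamma$ is unlimited if every $\Gamma(x)$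 is of the form $\mathsf{ch}(T)$ or is $\mathsf{end}$; linear if no $\Gamma(x)$ is of the form $\mathsf{ch}(T)$; $\Gamma_{\mathsf{lin}}$ is the largest linear sub-environment; $\Gamma$ is terminal if every $\Gamma(x)$ is $\mathsf{end}$ or $(\mathsf{end},\mathsf{end})$. A type is unlimited if it is $\mathsf{ch}(T)$ or $\mathsf{end}$. For disjoint domains, $\Gamma_1+\Gamma_2$ is the union. A recursion environment $\Delta$ is a finite partial function from $\mathcal R$ to type environments; $\Delta_\emptyset$ is the empty one; $\Delta_1+\Delta_2$ (defined when they agree on common domain) is the union; $\Delta, X:\Gamma$ extends $\Delta$. Addition of pairs: $(\Gamma_1,\Delta_1)+(\Gamma_2,\Delta_2)=(\Gamma_1+\Gamma_2,\Delta_1+\Delta_2)$, defined only when at least one of $\Delta_1,\Delta_2$ is $\Delta_\emptyset$, where $\Gamma_1$ is unlimited if $\Delta_1=\Delta_\emptyset$ and $\Gamma_2$ is linear if $\Delta_2\ne\Delta_\emptyset$. Judgments $\Gamma,\Delta\vdash P$ are derived by: (In-1) from $\Gamma, x^p:T_2, y:T_1, \Delta\vdash P$ infer $\Gamma, x^p:{?T_1}.T_2,\Delta\vdash x^p(y).P$, with $T_1\neq\mathsf{end}$; (In-2) from $\Gamma, x^p:\mathsf{ch}(T_1), y:T_1,\Delta\vdash P$ infer $\Gamma, x^p:\mathsf{ch}(T_1),\Delta\vdash x(y).P$, with $T_1\ne\mathsf{end}$; (Out-1) from $\Gamma, x^p:T_2,\Delta\vdash P$ infer $\Gamma, x^p:{!T_1}.T_2,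 y^q:T_1,\Delta\vdash x^p\langle y^q\rangle.P$, with $T_1\neq\mathsf{end}$; (Out-2) from $\Gamma, x:\mathsf{ch}(T_2), y^q:T_2,\Delta\vdash P$ infer $\Gamma, x:\mathsf{ch}(T_2), y^q:T_2,\Delta\vdash x\langle y^q\rangle.P$, with $T_2$ unlimited; (Par) from $\Gamma_1,\Delta_1\vdash P_1$ and $\Gamma_2,\Delta_2\vdash P_2$ infer $\Gamma,\Delta\vdash P_1\mid P_2$ where $(\Gamma,\Delta)=(\Gamma_1,\Delta_1)+(\Gamma_2,\Delta_2)$ is the pair addition above; (Session) from $\Gamma, x^+:S, x^-:\overline S,\Delta\vdash P$ infer $\Gamma,\Delta\vdash(\nu x:(S,\overline S))P$; (Nil) $\Gamma,\Delta\vdash\mathbf 0$ if $\Gamma$ unlimited; (Var) $\Gamma,\Delta\vdash X$ if $\Delta(X)=\Gamma_1$, $\mathrm{dom}(\Gamma)\subseteq\mathrm{dom}(\Gamma_1)$ and $\Gamma_{\mathsf{lin}}$ is terminal; (Rec) from $\Gamma,\Delta, X:\Gamma\vdash P$ infer $\Gamma,\Delta\vdash\mu X.P$; (Chan) from $\Gamma, x:\mathsf{ch}(T),\Delta_\emptyset\vdash P$ infer $\Gamma,\Delta_\emptyset\vdash(\nu x:\mathsf{ch}(T))P$. -}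

module Defs where

open import Data.Nat using (ℕ; zero; suc; _+_)
open import Data.Product using (Σ; ∃; _×_; _,_)
open import Data.Sum using (_⊎_)
open import Data.Maybe using (Maybe; just; nothing)
open import Data.List using (List; []; _∷_; _++_)
open import Data.List.Membership.Propositional using (_∈_)
open import Data.Unit using (⊤; tt)
open import Data.Empty using (⊥)
open import Data.Bool using (Bool; true; false)
open import Relation.Nullary using (¬_)
open import Relation.Binary.PropositionalEquality using (_≡_; _≢_; refl)

Name : Set
Name = ℕ

RVar : Set
RVar = ℕ

data Pol : Set where
  pos neg eps : Pol

PName : Set
PName = Name × Pol

data Ty : Set where
  ‵?_∙_ : Ty → Ty → Ty
  ‵!_∙_ : Ty → Ty → Ty
  end   : Ty
  ch    : Ty → Ty
  ⟨_,_⟩ : Ty → Ty → Ty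

data Dual : Ty → Ty → Set where
  d-end : Dual end end
  d-out : ∀ {T S S'} → Dual S S' → Dual (‵! T ∙ S) (‵? T ∙ S')
  d-inp : ∀ {T S S'} → Dual S S' → Dual (‵? T ∙ S) (‵! T ∙ S')

data UnlTy : Ty → Set where
  u-ch  : ∀ {T} → UnlTy (ch T)
  u-end : UnlTy end

IsCh : Ty → Set
IsCh (ch _) = ⊤
IsCh _      = ⊥

data TermTy : Ty → Set where
  t-end  : TermTy end
  t-pair : TermTy ⟨ end , end ⟩

data Proc : Set where
  inp  : PName → Name → Proc → Proc
  out  : PName → PName → Proc → Proc
  _∣_  : Proc → Proc → Proc
  ν    : Name → Ty → Proc → Proc
  μ    : RVar → Proc → Proc
  var  : RVar → Proc
  𝟎    : Proc

-- guardedness: every recursion variable occurrence lies under a prefix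
-- (the flag records whether we are under a prefix of the current μ-body)
GuardedAux : Bool → Proc → Set
GuardedAux b (inp x y P) = GuardedAux true P
GuardedAux b (out x y P) = GuardedAux true P
GuardedAux b (P ∣ Q)     = GuardedAux b P × GuardedAux b Q
GuardedAux b (ν x T P)   = GuardedAux b P
GuardedAux b (μ X P)     = GuardedAux false P
GuardedAux b (var X)     = b ≡ true
GuardedAux b 𝟎           = ⊤

Guarded : Proc → Set
Guarded = GuardedAux false

recBinders : Proc → List RVar
recBinders (inp x y P) = recBinders P
recBinders (out x y P) = recBinders P
recBinders (P ∣ Q)     = recBinders P ++ recBinders Q
recBinders (ν x T P)   = recBinders P
recBinders (μ X P)     = X ∷ recBinders P
recBinders (var X)     = []
recBinders 𝟎           = []

data Distinct {A : Set} : List A → Set where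
  []  : Distinct []
  _∷_ : ∀ {a as} → ¬ (a ∈ as) → Distinct as → Distinct (a ∷ as)

occ : RVar → Proc → ℕ
occ X (inp x y P) = occ X P
occ X (out x y P) = occ X P
occ X (P ∣ Q)     = occ X P + occ X Q
occ X (ν x T P)   = occ X P
occ X (μ Y P)     = occ X P
occ X (var Y) with X Data.Nat.≟ Y
... | Relation.Nullary.yes _ = 1
... | Relation.Nullary.no _  = 0
occ X 𝟎           = 0

record FPF (K V : Set) : Set where
  field
    look : K → Maybe V
    supp : List K
    fin  : ∀ k v → look k ≡ just v → k ∈ supp
open FPF public

Env : Set
Env = FPF PName Ty

REnv : Set
REnv = FPF RVar Env

-- m' = m , k : v   (k not in dom m)
Ext : ∀ {K V} → FPF K V → FPF K V → K → V → Set
Ext m' m k v = look m' k ≡ just v × look m k ≡ nothing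
             × (∀ k' → k' ≢ k → look m' k' ≡ look m k')

Unlimited : Env → Set
Unlimited Γ = ∀ k v → look Γ k ≡ just v → UnlTy v

Linear : Env → Set
Linear Γ = ∀ k v → look Γ k ≡ just v → ¬ IsCh v

Terminal : Env → Set
Terminal Γ = ∀ k v → look Γ k ≡ just v → TermTy v

linLook : Maybe Ty → Maybe Ty
linLook (just (ch _)) = nothing
linLook m             = m

linLook-just : ∀ m v → linLook m ≡ just v → m ≡ just v
linLook-just (just (‵? _ ∙ _)) v e = e
linLook-just (just (‵! _ ∙ _)) v e = e
linLook-just (just end) v e = e
linLook-just (just ⟨ _ , _ ⟩) v e = e
linLook-just nothing v ()
linLook-just (just (ch _)) v ()

linPart : Env → Env
linPart Γ = record
  { look = λ k → linLook (look Γ k)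
  ; supp = supp Γ
  ; fin  = λ k v e → fin Γ k v (linLook-just (look Γ k) v e)
  }

EmptyΔ : REnv → Set
EmptyΔ Δ = ∀ X → look Δ X ≡ nothing

EnvSum : Env → Env → Env → Set
EnvSum Γ1 Γ2 Γ = ∀ k → (look Γ1 k ≡ nothing × look Γ k ≡ look Γ2 k)
                     ⊎ (look Γ2 k ≡ nothing × look Γ k ≡ look Γ1 k)

REnvSum : REnv → REnv → REnv → Set
REnvSum Δ1 Δ2 Δ = ∀ X → (look Δ1 X ≡ nothing × look Δ X ≡ look Δ2 X)
                      ⊎ (look Δ2 X ≡ nothing × look Δ X ≡ look Δ1 X)
                      ⊎ (look Δ1 X ≡ look Δ2 X × look Δ X ≡ look Δ1 X)

PairSum : Env → REnv → Env → REnv → Env → REnv → Set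
PairSum Γ1 Δ1 Γ2 Δ2 Γ Δ =
  EnvSum Γ1 Γ2 Γ × REnvSum Δ1 Δ2 Δ × (EmptyΔ Δ1 ⊎ EmptyΔ Δ2)
  × (EmptyΔ Δ1 → Unlimited Γ1) × (¬ EmptyΔ Δ2 → Linear Γ2)

data _,_⊢_ : Env → REnv → Proc → Set where
  In-1 : ∀ {Γ Γx Γ1 Γ1' Δ x p y T1 T2 P}
       → Ext Γx Γ (x , p) (‵? T1 ∙ T2)
       → Ext Γ1 Γ (x , p) T2 → Ext Γ1' Γ1 (y , eps) T1 → T1 ≢ end
       → Γ1' , Δ ⊢ P
       → Γx , Δ ⊢ inp (x , p) y P
  In-2 : ∀ {Γ Γx Γ' Δ x p y T1 P}
       → Ext Γx Γ (x , p) (ch T1) → Ext Γ' Γx (y , eps) T1 → T1 ≢ end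
       → Γ' , Δ ⊢ P
       → Γx , Δ ⊢ inp (x , p) y P
  Out-1 : ∀ {Γ Γa Γc Γb Δ x p y q T1 T2 P}
       → Ext Γa Γ (x , p) (‵! T1 ∙ T2) → Ext Γc Γa (y , q) T1
       → Ext Γb Γ (x , p) T2 → T1 ≢ end
       → Γb , Δ ⊢ P
       → Γc , Δ ⊢ out (x , p) (y , q) P
  Out-2 : ∀ {Γ Γa Γc Δ x p y q T2 P}
       → Ext Γa Γ (x , p) (ch T2) → Ext Γc Γa (y , q) T2 → UnlTy T2
       → Γc , Δ ⊢ P
       → Γc , Δ ⊢ out (x , p) (y , q) P
  Par : ∀ {Γ1 Δ1 Γ2 Δ2 Γ Δ P1 P2}
       → Γ1 , Δ1 ⊢ P1 → Γ2 , Δ2 ⊢ P2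
       → PairSum Γ1 Δ1 Γ2 Δ2 Γ Δ
       → Γ , Δ ⊢ (P1 ∣ P2)
  Session : ∀ {Γ Γa Γb Δ x S S' P}
       → Dual S S' → Ext Γa Γ (x , pos) S → Ext Γb Γa (x , neg) S'
       → Γb , Δ ⊢ P
       → Γ , Δ ⊢ ν x ⟨ S , S' ⟩ P
  Nil : ∀ {Γ Δ} → Unlimited Γ → Γ , Δ ⊢ 𝟎
  Var : ∀ {Γ Γ1 Δ X}
       → look Δ X ≡ just Γ1
       → (∀ k v → look Γ k ≡ just v → ∃ λ v' → look Γ1 k ≡ just v')
       → Terminal (linPart Γ)
       → Γ , Δ ⊢ var X
  Rec : ∀ {Γ Δ Δ' X P}
       → Ext Δ' Δ X Γ
       → Γ , Δ' ⊢ P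
       → Γ , Δ ⊢ μ X P
  Chan : ∀ {Γ Γ' Δ x T P}
       → EmptyΔ Δ → Ext Γ' Γ (x , eps) (ch T)
       → Γ' , Δ ⊢ P
       → Γ , Δ ⊢ ν x (ch T) P

{-# OPTIONS --safe #-}
module Submission where

open import Defs
open import Data.Nat using (_≤_; _≟_; z≤n; s≤s)
open import Data.Nat.Properties using (+-identityʳ)
open import Data.Product using (_×_; _,_)
open import Data.Sum using (inj₁; inj₂)
open import Data.List using (List; _∷_; _++_)
open import Data.List.Membership.Propositional using (_∉_)
open import Data.List.Membership.Propositional.Properties using (∈-++⁺ˡ; ∈-++⁺ʳ)
open import Data.List.Relation.Unary.Any using (here; there)
open import Data.Maybe using (nothing)
open import Relation.Nullary using (yes; no)
open import Relation.Binary.PropositionalEquality using (_≡_; refl; sym; trans)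

-- An occurrence of X is typed by (Var), which needs X in the recursion
-- environment; (Par) hands a non-empty recursion environment to at most one
-- component, so only one branch of any parallel composition can contain X.
-- Since X is bound only once, nothing below the outer μX re-declares X.

∉-++⁻ˡ : ∀ {A : Set} {x : A} (xs : List A) {ys} → x ∉ xs ++ ys → x ∉ xs
∉-++⁻ˡ xs x∉ x∈ = x∉ (∈-++⁺ˡ x∈)

∉-++⁻ʳ : ∀ {A : Set} {x : A} (xs : List A) {ys} → x ∉ xs ++ ys → x ∉ ys
∉-++⁻ʳ xs x∉ x∈ = x∉ (∈-++⁺ʳ xs x∈)

REnvSum-look-nothing : ∀ Δ₁ Δ₂ Δ → REnvSum Δ₁ Δ₂ Δ
  → ∀ X → look Δ X ≡ nothing → look Δ₁ X ≡ nothing × look Δ₂ X ≡ nothing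
REnvSum-look-nothing _ _ _ sum X ΔX with sum X
... | inj₁ (Δ₁X , ΔX≡Δ₂X)        = Δ₁X , trans (sym ΔX≡Δ₂X) ΔX
... | inj₂ (inj₁ (Δ₂X , ΔX≡Δ₁X)) = trans (sym ΔX≡Δ₁X) ΔX , Δ₂X
... | inj₂ (inj₂ (Δ₁X≡Δ₂X , ΔX≡Δ₁X)) =
  trans (sym ΔX≡Δ₁X) ΔX , trans (sym Δ₁X≡Δ₂X) (trans (sym ΔX≡Δ₁X) ΔX)

occ-var≤1 : ∀ X Y → occ X (var Y) ≤ 1
occ-var≤1 X Y with X ≟ Y
... | yes _ = s≤s z≤n
... | no  _ = z≤n

occ≡0-if-undeclared : ∀ {X P Γ Δ} → X ∉ recBinders P → look Δ X ≡ nothing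
  → Γ , Δ ⊢ P → occ X P ≡ 0
occ≡0-if-undeclared X∉ ΔX (In-1 _ _ _ _ ⊢P)  = occ≡0-if-undeclared X∉ ΔX ⊢P
occ≡0-if-undeclared X∉ ΔX (In-2 _ _ _ ⊢P)    = occ≡0-if-undeclared X∉ ΔX ⊢P
occ≡0-if-undeclared X∉ ΔX (Out-1 _ _ _ _ ⊢P) = occ≡0-if-undeclared X∉ ΔX ⊢P
occ≡0-if-undeclared X∉ ΔX (Out-2 _ _ _ ⊢P)   = occ≡0-if-undeclared X∉ ΔX ⊢P
occ≡0-if-undeclared X∉ ΔX (Session _ _ _ ⊢P) = occ≡0-if-undeclared X∉ ΔX ⊢P
occ≡0-if-undeclared X∉ ΔX (Chan _ _ ⊢P)      = occ≡0-if-undeclared X∉ ΔX ⊢P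
occ≡0-if-undeclared X∉ ΔX (Nil _)            = refl
occ≡0-if-undeclared {X} X∉ ΔX (Rec (_ , _ , unchanged) ⊢P) =
  occ≡0-if-undeclared (λ X∈ → X∉ (there X∈))
    (trans (unchanged X (λ X≡Y → X∉ (here X≡Y))) ΔX) ⊢P
occ≡0-if-undeclared {X} X∉ ΔX (Var {X = Y} ΔY _ _) with X ≟ Y
... | yes refl with trans (sym ΔX) ΔY
...   | ()
occ≡0-if-undeclared X∉ ΔX (Var _ _ _) | no _ = refl
occ≡0-if-undeclared {X} {P₁ ∣ P₂} {Δ = Δ} X∉ ΔX
  (Par {Δ1 = Δ₁} {Δ2 = Δ₂} ⊢P₁ ⊢P₂ (_ , sum , _))
  with REnvSum-look-nothing Δ₁ Δ₂ Δ sum X ΔX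
... | Δ₁X , Δ₂X
  rewrite occ≡0-if-undeclared (∉-++⁻ˡ (recBinders P₁) X∉) Δ₁X ⊢P₁ =
  occ≡0-if-undeclared (∉-++⁻ʳ (recBinders P₁) X∉) Δ₂X ⊢P₂

occ≤1-if-unbound : ∀ {X P Γ Δ} → X ∉ recBinders P → Γ , Δ ⊢ P → occ X P ≤ 1
occ≤1-if-unbound X∉ (In-1 _ _ _ _ ⊢P)  = occ≤1-if-unbound X∉ ⊢P
occ≤1-if-unbound X∉ (In-2 _ _ _ ⊢P)    = occ≤1-if-unbound X∉ ⊢P
occ≤1-if-unbound X∉ (Out-1 _ _ _ _ ⊢P) = occ≤1-if-unbound X∉ ⊢P
occ≤1-if-unbound X∉ (Out-2 _ _ _ ⊢P)   = occ≤1-if-unbound X∉ ⊢P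
occ≤1-if-unbound X∉ (Session _ _ _ ⊢P) = occ≤1-if-unbound X∉ ⊢P
occ≤1-if-unbound X∉ (Chan _ _ ⊢P)      = occ≤1-if-unbound X∉ ⊢P
occ≤1-if-unbound X∉ (Nil _)            = z≤n
occ≤1-if-unbound X∉ (Rec _ ⊢P)         = occ≤1-if-unbound (λ X∈ → X∉ (there X∈)) ⊢P
occ≤1-if-unbound {X} X∉ (Var {X = Y} _ _ _) = occ-var≤1 X Y
occ≤1-if-unbound {X} {P₁ ∣ P₂} X∉ (Par ⊢P₁ ⊢P₂ (_ , _ , inj₁ Δ₁-empty , _))
  rewrite occ≡0-if-undeclared (∉-++⁻ˡ (recBinders P₁) X∉) (Δ₁-empty X) ⊢P₁ =
  occ≤1-if-unbound (∉-++⁻ʳ (recBinders P₁) X∉) ⊢P₂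
occ≤1-if-unbound {X} {P₁ ∣ P₂} X∉ (Par ⊢P₁ ⊢P₂ (_ , _ , inj₂ Δ₂-empty , _))
  rewrite occ≡0-if-undeclared (∉-++⁻ʳ (recBinders P₁) X∉) (Δ₂-empty X) ⊢P₂
        | +-identityʳ (occ X P₁) =
  occ≤1-if-unbound (∉-++⁻ˡ (recBinders P₁) X∉) ⊢P₁

mainTheorem7 : (X : RVar) (P : Proc) (Γ : Env) (Δ : REnv)
    → Guarded (μ X P) → Distinct (recBinders (μ X P))
    → Γ , Δ ⊢ μ X P
    → occ X P ≤ 1
mainTheorem7 X P Γ Δ _ (X∉P ∷ _) (Rec _ ⊢P) = occ≤1-if-unbound X∉P ⊢P
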